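{- Let $G$ be a connected graph of order $n\geq 2$. Then $\overset{\rightarrow}{\gamma}_{LD}(G)=n-1$ if and only if $n=3$ or $G$ is a star.
   Context: A star is a graph isomorphic to $K_{1,m}$. For an orientation $D$ of a graph $G=(V,E)$ (each edge given exactly one direction), $S\subseteq V$ is locating-dominating in $D$ if every $u\notin S$ has an in-neighbour in $S$ and distinct $u,v\notin S$ have distinct sets of in-neighbours in $S$; $\gamma_{LD}(D)$ is the minimum size. $\overset{\rightarrow}{\gamma}_{LD}(G)=\min_D\gamma_{LD}(D)$ over all orientations $D$ of $G$. -}

module Defs where

open import Data.Nat using (ℕ; suc; _≤_)
open import Data.Fin using (Fin; zero)
open import Data.Fin.Subset using (Subset; _∈_; _∉_; ∣_∣)
open import Data.Bool using (Bool; true; false; not)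
open import Data.Product using (Σ; ∃; _×_; _,_)
open import Data.Sum using (_⊎_)
open import Relation.Binary.PropositionalEquality using (_≡_; _≢_)
open import Relation.Nullary using (¬_)
open import Function.Bundles using (_⤖_; Bijection; _⇔_)

record Graph (n : ℕ) : Set where
  field
    Adj   : Fin n → Fin n → Bool
    sym   : ∀ u v → Adj u v ≡ Adj v u
    irrefl : ∀ u → Adj u u ≡ false
open Graph public

data Walk {n : ℕ} (G : Graph n) : Fin n → Fin n → Set where
  here  : ∀ {u} → Walk G u u
  step  : ∀ {u w v} → Adj G u w ≡ true → Walk G w v → Walk G u v

Connected : ∀ {n} → Graph n → Set
Connected G = ∀ u v → Walk G u v

-- An orientation of G: every edge receives exactly one direction,
-- and arcs occur only along edges.  Arc u v means u → v.
record Orientation {n : ℕ} (G : Graph n) : Set where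
  field
    Arc      : Fin n → Fin n → Bool
    onEdges  : ∀ u v → Arc u v ≡ true → Adj G u v ≡ true
    oneDir   : ∀ u v → Adj G u v ≡ true → Arc u v ≡ not (Arc v u)
open Orientation public

LocDom : ∀ {n} {G : Graph n} → Orientation G → Subset n → Set
LocDom {n} D S =
  (∀ u → u ∉ S → ∃ λ w → w ∈ S × Arc D w u ≡ true)
  × (∀ u v → u ∉ S → v ∉ S → u ≢ v →
       ¬ (∀ w → w ∈ S → Arc D w u ≡ Arc D w v))

OrientedLDNumber : ∀ {n} → Graph n → ℕ → Set
OrientedLDNumber {n} G k =
  (Σ (Orientation G) λ D → Σ (Subset n) λ S → LocDom D S × ∣ S ∣ ≡ k)
  × (∀ (D : Orientation G) (S : Subset n) → LocDom D S → k ≤ ∣ S ∣)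

Star : (m : ℕ) → Graph (suc m)
Star m = record { Adj = adj ; sym = symm ; irrefl = irr }
  where
  adj : Fin (suc m) → Fin (suc m) → Bool
  adj zero zero = false
  adj zero (Fin.suc _) = true
  adj (Fin.suc _) zero = true
  adj (Fin.suc _) (Fin.suc _) = false
  symm : ∀ u v → adj u v ≡ adj v u
  symm zero zero = _≡_.refl
  symm zero (Fin.suc _) = _≡_.refl
  symm (Fin.suc _) zero = _≡_.refl
  symm (Fin.suc _) (Fin.suc _) = _≡_.refl
  irr : ∀ u → adj u u ≡ false
  irr zero = _≡_.refl
  irr (Fin.suc _) = _≡_.refl

_≅_ : ∀ {n k} → Graph n → Graph k → Set
_≅_ {n} {k} G H = Σ (Fin n ⤖ Fin k) λ f →
  ∀ u v → Adj G u v ≡ Adj H (Bijection.to f u) (Bijection.to f v)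

IsStar : ∀ {n} → Graph n → Set
IsStar G = ∃ λ m → G ≅ Star m

-- In any orientation an edge u → v makes V ∖ {v} locating-dominating, so n − 1 is always attained.
-- It is also a lower bound for stars, where every arc into a leaf comes from the centre (so two
-- leaves outside S would share their in-neighbours in S), and for n = 3, where two outside vertices
-- can only be dominated by the third one. Conversely, a path a–b–c–d on four distinct vertices,
-- oriented a → b → c → d, admits the smaller set V ∖ {b, d}, in which c separates b from d.
-- A connected graph without such a path and with n ≠ 3 has no triangle, hence a pendant edge c–l;
-- every neighbour of a neighbour of c is then c itself, which forces G to be the star centred at c.

module Submission where

open import Defs hiding (sym)
open import Data.Nat as ℕ using (ℕ; _≥_; _∸_; _≤_; _<_; z≤n; s≤s; _<ᵇ_; _≡ᵇ_)
open import Data.Nat.Properties using (≤-trans; n<1+n; 1+n≰n; ≤-antisym; <⇒≱; <⇒<ᵇ)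
open import Data.Fin using (Fin; zero; suc; toℕ; _≟_)
open import Data.Fin.Properties using (any?; injective⇒≤; toℕ-injective)
open import Data.Fin.Subset using (Subset; _∈_; _∉_; ∣_∣; ∁; ⁅_⁆; _-_; _⊆_)
open import Data.Fin.Subset.Properties
  using (_∈?_; ∈⊤; ∣⊤∣≡n; ∣∁p∣≡n∸∣p∣; ∣⁅x⁆∣≡1; x∈⁅y⁆⇒x≡y; x≢y⇒x∉⁅y⁆; x∉p⇒x∈∁p; x∉∁p⇒x∈p; x∈∁p⇒x∉p; x∈⁅x⁆;
         p⊆q⇒∣p∣≤∣q∣; x∈p∧x≢y⇒x∈p-y; x∈p⇒∣p-x∣<∣p∣)
open import Data.Fin.Permutation using (transpose)
open import Data.List using (List; []; _∷_; length; lookup)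
open import Data.List.Relation.Unary.All as All using (All; []; _∷_)
open import Data.List.Relation.Unary.Any using (here; there) renaming (any? to anyₗ?)
open import Data.List.Relation.Unary.Any.Properties using (lookup-index)
open import Data.List.Relation.Unary.Unique.Propositional using (Unique; []; _∷_)
open import Data.List.Membership.Propositional using () renaming (_∈_ to _∈ₗ_; _∉_ to _∉ₗ_)
open import Data.Bool using (Bool; true; false; not; _∧_; _∨_; _xor_; if_then_else_)
open import Data.Bool.Properties using (T-≡) renaming (_≟_ to _≟ᵇ_)
open import Data.Product using (Σ; module Σ; ∃; ∃₂; _×_; _,_; proj₁; proj₂)
open import Data.Sum using (_⊎_; inj₁; inj₂)
open import Data.Empty using (⊥-elim)
open import Relation.Nullary using (¬_; Dec; yes; no; does)
open import Relation.Nullary.Decidable using (_×-dec_; ¬?; dec-true; dec-false; does-⇔; decidable-stable)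
open import Relation.Unary using (Pred; Decidable)
open import Relation.Binary.PropositionalEquality
  using (_≡_; refl; sym; trans; cong; cong₂; subst; subst₂; _≢_; ≢-sym; module ≡-Reasoning)
open import Function using (_∘_)
open import Function.Bundles using (_⇔_; _⤖_; Bijection; Equivalence; mk⇔)
open import Function.Properties.Inverse using (↔⇒⤖)

private
  variable
    n : ℕ
    G : Graph n
    u v w x : Fin n

true≢false : true ≢ false
true≢false ()

adj-sym : (G : Graph n) → Adj G u v ≡ true → Adj G v u ≡ true
adj-sym {u = u} {v} G e = trans (Graph.sym G v u) e

adj⇒≢ : (G : Graph n) → Adj G u v ≡ true → u ≢ v
adj⇒≢ {u = u} G e refl = true≢false (trans (sym e) (irrefl G u))

walk⇒neighbour : Walk G u v → u ≢ v → ∃ λ w → Adj G u w ≡ true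
walk⇒neighbour here       u≢u = ⊥-elim (u≢u refl)
walk⇒neighbour (step e _) _   = _ , e

walk-crosses : ∀ {ℓ} {P : Pred (Fin n) ℓ} → Decidable P → Walk G u v → ¬ P u → P v →
  ∃₂ λ x y → ¬ P x × P y × Adj G x y ≡ true
walk-crosses P? here ¬Pu Pu = ⊥-elim (¬Pu Pu)
walk-crosses P? (step {w = w} e walk) ¬Pu Pv with P? w
... | yes Pw = _ , w , ¬Pu , Pw , e
... | no ¬Pw = walk-crosses P? walk ¬Pw Pv

arc-or-reverse : (D : Orientation G) → Adj G u v ≡ true → Arc D u v ≡ true ⊎ Arc D v u ≡ true
arc-or-reverse {u = u} {v} D e with Arc D v u in vu
... | true  = inj₂ refl
... | false = inj₁ (trans (oneDir D u v e) (cong not vu))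

unique⊆⇒length≤ : {xs : List (Fin n)} {p : Subset n} → Unique xs → All (_∈ p) xs → length xs ≤ ∣ p ∣
unique⊆⇒length≤ []                []           = z≤n
unique⊆⇒length≤ {xs = x ∷ xs} {p} (x≢xs ∷ uxs) (x∈p ∷ xs⊆p) =
  ≤-trans (s≤s (unique⊆⇒length≤ uxs xs⊆p-x)) (x∈p⇒∣p-x∣<∣p∣ x∈p)
  where
  xs⊆p-x : All (_∈ p - x) xs
  xs⊆p-x = All.zipWith (λ (y∈p , x≢y) → x∈p∧x≢y⇒x∈p-y y∈p (≢-sym x≢y)) (xs⊆p , x≢xs)

unique⇒length≤n : {xs : List (Fin n)} → Unique xs → length xs ≤ n
unique⇒length≤n {n} {xs} uxs =
  subst (length xs ≤_) (∣⊤∣≡n n) (unique⊆⇒length≤ uxs (All.tabulate λ _ → ∈⊤))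

covering⇒n≤length : (xs : List (Fin n)) → (∀ x → x ∈ₗ xs) → n ≤ length xs
covering⇒n≤length xs cover = injective⇒≤ λ {x} {y} e →
  trans (lookup-index (cover x)) (trans (cong (lookup xs) e) (sym (lookup-index (cover y))))

∣∁⁅x⁆∣≡n∸1 : (x : Fin n) → ∣ ∁ ⁅ x ⁆ ∣ ≡ n ∸ 1
∣∁⁅x⁆∣≡n∸1 {n} x = trans (∣∁p∣≡n∸∣p∣ ⁅ x ⁆) (cong (n ∸_) (∣⁅x⁆∣≡1 x))

≢⇒∈∁⁅x⁆ : u ≢ x → u ∈ ∁ ⁅ x ⁆
≢⇒∈∁⁅x⁆ u≢x = x∉p⇒x∈∁p (x≢y⇒x∉⁅y⁆ u≢x)

∉∁⁅x⁆⇒≡ : u ∉ ∁ ⁅ x ⁆ → u ≡ x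
∉∁⁅x⁆⇒≡ {x = x} u∉ = x∈⁅y⁆⇒x≡y x (x∉∁p⇒x∈p u∉)

outside⊆⁅x⁆⇒n∸1≤∣S∣ : {S : Subset n} (x : Fin n) → (∀ {y} → y ∉ S → y ≡ x) → n ∸ 1 ≤ ∣ S ∣
outside⊆⁅x⁆⇒n∸1≤∣S∣ {S = S} x outside =
  subst (_≤ ∣ S ∣) (∣∁⁅x⁆∣≡n∸1 x) (p⊆q⇒∣p∣≤∣q∣ ∁⁅x⁆⊆S)
  where
  ∁⁅x⁆⊆S : ∁ ⁅ x ⁆ ⊆ S
  ∁⁅x⁆⊆S {y} y∈∁⁅x⁆ = decidable-stable (y ∈? S) λ y∉S →
    x∈∁p⇒x∉p y∈∁⁅x⁆ (subst (_∈ ⁅ x ⁆) (sym (outside y∉S)) (x∈⁅x⁆ x))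

outside-unique⇒n∸1≤∣S∣ : {S : Subset n} → (∀ {u v} → u ∉ S → v ∉ S → u ≡ v) → n ∸ 1 ≤ ∣ S ∣
outside-unique⇒n∸1≤∣S∣ {ℕ.zero}    _      = z≤n
outside-unique⇒n∸1≤∣S∣ {ℕ.suc n} {S} unique with any? (λ u → ¬? (u ∈? S))
... | yes (x , x∉S) = outside⊆⁅x⁆⇒n∸1≤∣S∣ x λ y∉S → unique y∉S x∉S
... | no none       = outside⊆⁅x⁆⇒n∸1≤∣S∣ zero λ y∉S → ⊥-elim (none (_ , y∉S))

fin3-third : {u v x y : Fin 3} → u ≢ v → x ≢ u → x ≢ v → y ≢ u → y ≢ v → x ≡ y
fin3-third {u} {v} {x} {y} u≢v x≢u x≢v y≢u y≢v with x ≟ y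
... | yes x≡y = x≡y
... | no x≢y = ⊥-elim (1+n≰n (unique⇒length≤n {xs = u ∷ v ∷ x ∷ y ∷ []}
  ((u≢v ∷ ≢-sym x≢u ∷ ≢-sym y≢u ∷ []) ∷ (≢-sym x≢v ∷ ≢-sym y≢v ∷ []) ∷ (x≢y ∷ []) ∷ [] ∷ [])))

_<ₗₑₓ_ : ℕ × ℕ → ℕ × ℕ → Bool
(r , i) <ₗₑₓ (s , j) = (r <ᵇ s) ∨ ((r ≡ᵇ s) ∧ (i <ᵇ j))

<ᵇ-flip : ∀ {i j} → i ≢ j → (i <ᵇ j) ≡ not (j <ᵇ i)
<ᵇ-flip {ℕ.zero}  {ℕ.zero}  i≢j = ⊥-elim (i≢j refl)
<ᵇ-flip {ℕ.zero}  {ℕ.suc j} _   = refl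
<ᵇ-flip {ℕ.suc i} {ℕ.zero}  _   = refl
<ᵇ-flip {ℕ.suc i} {ℕ.suc j} i≢j = <ᵇ-flip (λ i≡j → i≢j (cong ℕ.suc i≡j))

<ₗₑₓ-flip : ∀ r s {i j} → i ≢ j → (r , i) <ₗₑₓ (s , j) ≡ not ((s , j) <ₗₑₓ (r , i))
<ₗₑₓ-flip ℕ.zero    ℕ.zero    i≢j = <ᵇ-flip i≢j
<ₗₑₓ-flip ℕ.zero    (ℕ.suc s) _   = refl
<ₗₑₓ-flip (ℕ.suc r) ℕ.zero    _   = refl
<ₗₑₓ-flip (ℕ.suc r) (ℕ.suc s) i≢j = <ₗₑₓ-flip r s i≢j

rankOrientation : (G : Graph n) → (Fin n → ℕ) → Orientation G
rankOrientation {n} G rank = record { Arc = arc ; onEdges = onEdges′ ; oneDir = oneDir′ }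
  where
  key : Fin n → ℕ × ℕ
  key u = rank u , toℕ u
  arc : Fin n → Fin n → Bool
  arc u v = Adj G u v ∧ (key u <ₗₑₓ key v)
  onEdges′ : ∀ u v → arc u v ≡ true → Adj G u v ≡ true
  onEdges′ u v e with Adj G u v
  ... | true  = refl
  ... | false = e
  oneDir′ : ∀ u v → Adj G u v ≡ true → arc u v ≡ not (arc v u)
  oneDir′ u v e rewrite Graph.sym G v u | e =
    <ₗₑₓ-flip (rank u) (rank v) λ same → adj⇒≢ G e (toℕ-injective same)

rank<⇒arc : (G : Graph n) (rank : Fin n → ℕ) →
  Adj G u v ≡ true → rank u < rank v → Arc (rankOrientation G rank) u v ≡ true
rank<⇒arc G rank e lt rewrite e | Equivalence.to T-≡ (<⇒<ᵇ lt) = refl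

locDom-∁⁅x⁆ : (D : Orientation G) → Arc D w x ≡ true → LocDom D (∁ ⁅ x ⁆)
locDom-∁⁅x⁆ {G = G} {x = x} D wx = dominated , located
  where
  dominated : ∀ u → u ∉ ∁ ⁅ x ⁆ → ∃ λ w → w ∈ ∁ ⁅ x ⁆ × Arc D w u ≡ true
  dominated u u∉ rewrite ∉∁⁅x⁆⇒≡ u∉ = _ , ≢⇒∈∁⁅x⁆ (adj⇒≢ G (onEdges D _ _ wx)) , wx
  located : ∀ u v → u ∉ ∁ ⁅ x ⁆ → v ∉ ∁ ⁅ x ⁆ → u ≢ v → ¬ (∀ w → w ∈ ∁ ⁅ x ⁆ → Arc D w u ≡ Arc D w v)
  located u v u∉ v∉ u≢v _ = u≢v (trans (∉∁⁅x⁆⇒≡ u∉) (sym (∉∁⁅x⁆⇒≡ v∉)))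

edge⇒locDom-of-size-n∸1 : (D : Orientation G) → Adj G u v ≡ true →
  Σ (Subset n) λ S → LocDom D S × ∣ S ∣ ≡ n ∸ 1
edge⇒locDom-of-size-n∸1 {u = u} {v} D e with arc-or-reverse D e
... | inj₁ u→v = ∁ ⁅ v ⁆ , locDom-∁⁅x⁆ D u→v , ∣∁⁅x⁆∣≡n∸1 v
... | inj₂ v→u = ∁ ⁅ u ⁆ , locDom-∁⁅x⁆ D v→u , ∣∁⁅x⁆∣≡n∸1 u

locDom-of-size-n∸1 : 2 ≤ n → Connected G →
  Σ (Orientation G) λ D → Σ (Subset n) λ S → LocDom D S × ∣ S ∣ ≡ n ∸ 1
locDom-of-size-n∸1 {G = G} (s≤s (s≤s _)) conn =
  D , edge⇒locDom-of-size-n∸1 D (proj₂ (walk⇒neighbour (conn zero (suc zero)) λ ()))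
  where
  D : Orientation G
  D = rankOrientation G toℕ

Centred : Graph n → Fin n → Set
Centred G c = ∀ {u v} → u ≢ c → v ≢ c → Adj G u v ≡ false

Universal : Graph n → Fin n → Set
Universal G c = ∀ {v} → v ≢ c → Adj G c v ≡ true

record StarCentre (G : Graph n) (c : Fin n) : Set where
  field
    universal : Universal G c
    centred   : Centred G c

module _ {G : Graph n} {c : Fin n} (centred : Centred G c)
         (D : Orientation G) {S : Subset n} (ld : LocDom D S) where

  open Σ ld using () renaming (proj₁ to dominated; proj₂ to located)

  private
    arc-into-leaf⇒from-centre : v ≢ c → Arc D w v ≡ true → w ≡ c
    arc-into-leaf⇒from-centre {w = w} v≢c wv = decidable-stable (w ≟ c) λ w≢c →
      true≢false (trans (sym (onEdges D _ _ wv)) (centred w≢c v≢c))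

    outside-leaf⇒centre-dominates : u ∉ S → u ≢ c → c ∈ S × Arc D c u ≡ true
    outside-leaf⇒centre-dominates u∉S u≢c
      with w , w∈S , wu ← dominated _ u∉S
      with refl ← arc-into-leaf⇒from-centre u≢c wu = w∈S , wu

    arc-between-leaves : w ≢ c → v ≢ c → Arc D w v ≡ false
    arc-between-leaves {w = w} {v = v} w≢c v≢c with Arc D w v in wv
    ... | true  = ⊥-elim (w≢c (arc-into-leaf⇒from-centre v≢c wv))
    ... | false = refl

    outside-unique : u ∉ S → v ∉ S → u ≡ v
    outside-unique {u} {v} u∉S v∉S with u ≟ v | u ≟ c | v ≟ c
    ... | yes u≡v | _        | _        = u≡v
    ... | no u≢v  | yes refl | _        = ⊥-elim (u∉S (proj₁ (outside-leaf⇒centre-dominates v∉S (≢-sym u≢v))))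
    ... | no u≢v  | no _     | yes refl = ⊥-elim (v∉S (proj₁ (outside-leaf⇒centre-dominates u∉S u≢v)))
    ... | no u≢v  | no u≢c   | no v≢c   = ⊥-elim (located u v u∉S v∉S u≢v same-in-neighbours)
      where
      same-in-neighbours : ∀ w → w ∈ S → Arc D w u ≡ Arc D w v
      same-in-neighbours w _ with w ≟ c
      ... | yes refl = trans (proj₂ (outside-leaf⇒centre-dominates u∉S u≢c))
                             (sym (proj₂ (outside-leaf⇒centre-dominates v∉S v≢c)))
      ... | no w≢c   = trans (arc-between-leaves w≢c u≢c) (sym (arc-between-leaves w≢c v≢c))

  centred⇒n∸1≤∣S∣ : n ∸ 1 ≤ ∣ S ∣
  centred⇒n∸1≤∣S∣ = outside-unique⇒n∸1≤∣S∣ outside-unique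

order3⇒2≤∣S∣ : {G : Graph 3} (D : Orientation G) {S : Subset 3} → LocDom D S → 2 ≤ ∣ S ∣
order3⇒2≤∣S∣ {G = G} D {S} (dominated , located) = outside-unique⇒n∸1≤∣S∣ outside-unique
  where
  ∈⇒≢∉ : w ∈ S → u ∉ S → w ≢ u
  ∈⇒≢∉ w∈S u∉S refl = u∉S w∈S
  outside-unique : u ∉ S → v ∉ S → u ≡ v
  outside-unique {u} {v} u∉S v∉S with u ≟ v
  ... | yes u≡v = u≡v
  ... | no u≢v  = ⊥-elim (located u v u∉S v∉S u≢v same-in-neighbours)
    where
    only-dominator : ∀ {w y} → w ∈ S → y ∈ S → w ≡ y
    only-dominator w∈S y∈S = fin3-third u≢v (∈⇒≢∉ w∈S u∉S) (∈⇒≢∉ w∈S v∉S) (∈⇒≢∉ y∈S u∉S) (∈⇒≢∉ y∈S v∉S)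
    arc-from-S : ∀ {w} {x} → x ∉ S → w ∈ S → Arc D w x ≡ true
    arc-from-S x∉S w∈S with y , y∈S , yx ← dominated _ x∉S
      with refl ← only-dominator w∈S y∈S = yx
    same-in-neighbours : ∀ w → w ∈ S → Arc D w u ≡ Arc D w v
    same-in-neighbours w w∈S = trans (arc-from-S u∉S w∈S) (sym (arc-from-S v∉S w∈S))

record Path4 (G : Graph n) : Set where
  field
    a b c d : Fin n
    ab : Adj G a b ≡ true
    bc : Adj G b c ≡ true
    cd : Adj G c d ≡ true
    a≢c : a ≢ c
    a≢d : a ≢ d
    b≢d : b ≢ d

path4⇒locDom<n∸1 : Path4 G →
  Σ (Orientation G) λ D → Σ (Subset n) λ S → LocDom D S × ∣ S ∣ < n ∸ 1
path4⇒locDom<n∸1 {n} {G} P = D , S , (dominated , located) , ∣S∣<n∸1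
  where
  open Path4 P
  a≢b : a ≢ b
  a≢b = adj⇒≢ G ab
  b≢c : b ≢ c
  b≢c = adj⇒≢ G bc
  c≢d : c ≢ d
  c≢d = adj⇒≢ G cd

  rank : Fin n → ℕ
  rank v = if does (v ≟ b) then 1 else if does (v ≟ c) then 2 else if does (v ≟ d) then 3 else 0

  D : Orientation G
  D = rankOrientation G rank

  rank-a : rank a ≡ 0
  rank-a rewrite dec-false (a ≟ b) a≢b | dec-false (a ≟ c) a≢c | dec-false (a ≟ d) a≢d = refl
  rank-b : rank b ≡ 1
  rank-b rewrite dec-true (b ≟ b) refl = refl
  rank-c : rank c ≡ 2
  rank-c rewrite dec-false (c ≟ b) (≢-sym b≢c) | dec-true (c ≟ c) refl = refl
  rank-d : rank d ≡ 3
  rank-d rewrite dec-false (d ≟ b) (≢-sym b≢d) | dec-false (d ≟ c) (≢-sym c≢d) | dec-true (d ≟ d) refl = refl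

  a→b : Arc D a b ≡ true
  a→b = rank<⇒arc G rank ab (subst₂ _<_ (sym rank-a) (sym rank-b) (n<1+n _))
  b→c : Arc D b c ≡ true
  b→c = rank<⇒arc G rank bc (subst₂ _<_ (sym rank-b) (sym rank-c) (n<1+n _))
  c→d : Arc D c d ≡ true
  c→d = rank<⇒arc G rank cd (subst₂ _<_ (sym rank-c) (sym rank-d) (n<1+n _))
  c↛b : Arc D c b ≡ false
  c↛b = trans (oneDir D c b (adj-sym G bc)) (cong not b→c)

  S : Subset n
  S = ∁ ⁅ b ⁆ - d

  ∈S : u ≢ b → u ≢ d → u ∈ S
  ∈S u≢b u≢d = x∈p∧x≢y⇒x∈p-y (≢⇒∈∁⁅x⁆ u≢b) u≢d

  ∉S⇒b⊎d : u ∉ S → u ≡ b ⊎ u ≡ d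
  ∉S⇒b⊎d {u} u∉S with u ≟ b | u ≟ d
  ... | yes u≡b | _       = inj₁ u≡b
  ... | no _    | yes u≡d = inj₂ u≡d
  ... | no u≢b  | no u≢d  = ⊥-elim (u∉S (∈S u≢b u≢d))

  c∈S : c ∈ S
  c∈S = ∈S (≢-sym b≢c) c≢d

  dominated : ∀ u → u ∉ S → ∃ λ w → w ∈ S × Arc D w u ≡ true
  dominated u u∉S with ∉S⇒b⊎d u∉S
  ... | inj₁ refl = a , ∈S a≢b a≢d , a→b
  ... | inj₂ refl = c , c∈S , c→d

  located : ∀ u v → u ∉ S → v ∉ S → u ≢ v → ¬ (∀ w → w ∈ S → Arc D w u ≡ Arc D w v)
  located u v u∉S v∉S u≢v same with ∉S⇒b⊎d u∉S | ∉S⇒b⊎d v∉S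
  ... | inj₁ refl | inj₁ refl = u≢v refl
  ... | inj₂ refl | inj₂ refl = u≢v refl
  ... | inj₁ refl | inj₂ refl = true≢false (trans (sym c→d) (trans (sym (same c c∈S)) c↛b))
  ... | inj₂ refl | inj₁ refl = true≢false (trans (sym c→d) (trans (same c c∈S) c↛b))

  ∣S∣<n∸1 : ∣ S ∣ < n ∸ 1
  ∣S∣<n∸1 = subst (∣ S ∣ <_) (∣∁⁅x⁆∣≡n∸1 b) (x∈p⇒∣p-x∣<∣p∣ (≢⇒∈∁⁅x⁆ (≢-sym b≢d)))

_∈ₗ?_ : (x : Fin n) (xs : List (Fin n)) → Dec (x ∈ₗ xs)
x ∈ₗ? xs = anyₗ? (x ≟_) xs

three-distinct⇒outsider : n ≢ 3 → {a b c : Fin n} → a ≢ b → a ≢ c → b ≢ c →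
  ∃ λ z → z ∉ₗ a ∷ b ∷ c ∷ []
three-distinct⇒outsider {n} n≢3 {a} {b} {c} a≢b a≢c b≢c with any? (λ z → ¬? (z ∈ₗ? (a ∷ b ∷ c ∷ [])))
... | yes outsider = outsider
... | no  none     = ⊥-elim (n≢3 (≤-antisym n≤3 3≤n))
  where
  n≤3 : n ≤ 3
  n≤3 = covering⇒n≤length _ λ z → decidable-stable (z ∈ₗ? _) λ z∉T → none (z , z∉T)
  3≤n : 3 ≤ n
  3≤n = unique⇒length≤n ((a≢b ∷ a≢c ∷ []) ∷ (b≢c ∷ []) ∷ [] ∷ [])

edge+triangle⇒path4 : Adj G x u ≡ true → Adj G u v ≡ true → Adj G v w ≡ true → Adj G w u ≡ true →
  x ≢ v → x ≢ w → Path4 G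
edge+triangle⇒path4 {G = G} xu uv vw wu x≢v x≢w = record
  { ab = xu ; bc = uv ; cd = vw ; a≢c = x≢v ; a≢d = x≢w ; b≢d = ≢-sym (adj⇒≢ G wu) }

triangle⇒path4 : {G : Graph n} → n ≢ 3 → Connected G → ∀ {a b c} →
  Adj G a b ≡ true → Adj G b c ≡ true → Adj G c a ≡ true → Path4 G
triangle⇒path4 {n = n} {G = G} n≢3 conn {a} {b} {c} ab bc ca =
  let z , z∉T = three-distinct⇒outsider n≢3 (adj⇒≢ G ab) (≢-sym (adj⇒≢ G ca)) (adj⇒≢ G bc)
  in attach (walk-crosses (_∈ₗ? T) (conn z a) z∉T (here refl))
  where
  T : List (Fin n)
  T = a ∷ b ∷ c ∷ []
  attach : (∃₂ λ x y → x ∉ₗ T × y ∈ₗ T × Adj G x y ≡ true) → Path4 G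
  attach (x , _ , x∉T , here refl , xa) =
    edge+triangle⇒path4 xa ab bc ca (x∉T ∘ there ∘ here) (x∉T ∘ there ∘ there ∘ here)
  attach (x , _ , x∉T , there (here refl) , xb) =
    edge+triangle⇒path4 xb bc ca ab (x∉T ∘ there ∘ there ∘ here) (x∉T ∘ here)
  attach (x , _ , x∉T , there (there (here refl)) , xc) =
    edge+triangle⇒path4 xc ca ab bc (x∉T ∘ here) (x∉T ∘ there ∘ here)

sole-neighbour-or-other : (G : Graph n) (u w : Fin n) →
  (∀ {t} → Adj G u t ≡ true → t ≡ w) ⊎ ∃ λ t → Adj G u t ≡ true × t ≢ w
sole-neighbour-or-other G u w with any? (λ t → (Adj G u t ≟ᵇ true) ×-dec ¬? (t ≟ w))
... | yes other = inj₂ other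
... | no  none  = inj₁ λ {t} ut → decidable-stable (t ≟ w) λ t≢w → none (t , ut , t≢w)

Pendant : Graph n → Fin n → Fin n → Set
Pendant G c l = Adj G c l ≡ true × (∀ {t} → Adj G l t ≡ true → t ≡ c)

path4-free⇒pendant : {G : Graph n} → 2 ≤ n → n ≢ 3 → Connected G → ¬ Path4 G → ∃₂ (Pendant G)
path4-free⇒pendant {G = G} (s≤s (s≤s _)) n≢3 conn no-path4
  with y , 0y ← walk⇒neighbour (conn zero (suc zero)) (λ ())
  with sole-neighbour-or-other G zero y | sole-neighbour-or-other G y zero
... | inj₁ only-y | _           = y , zero , adj-sym G 0y , only-y
... | inj₂ _      | inj₁ only-0 = zero , y , 0y , only-0
... | inj₂ (x , 0x , x≢y) | inj₂ (z , yz , z≢0) with x ≟ z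
...   | yes refl = ⊥-elim (no-path4 (triangle⇒path4 n≢3 conn 0y yz (adj-sym G 0x)))
...   | no x≢z   = ⊥-elim (no-path4 (record
  { ab = adj-sym G 0x ; bc = 0y ; cd = yz ; a≢c = x≢y ; a≢d = x≢z ; b≢d = ≢-sym z≢0 }))

module _ {G : Graph n} (conn : Connected G) (no-path4 : ¬ Path4 G)
         {c l : Fin n} (pendant : Pendant G c l) where

  private
    neighbour-of-neighbour : Adj G c u ≡ true → Adj G u v ≡ true → v ≡ c
    neighbour-of-neighbour {u} {v} cu uv = decidable-stable (v ≟ c) λ v≢c → no-path4 (record
      { ab = adj-sym G (proj₁ pendant) ; bc = cu ; cd = uv
      ; a≢c = λ { refl → v≢c (proj₂ pendant uv) }
      ; a≢d = λ { refl → adj⇒≢ G cu (sym (proj₂ pendant (adj-sym G uv))) }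
      ; b≢d = ≢-sym v≢c })

    walk-stays-near-centre : u ≡ c ⊎ Adj G c u ≡ true → Walk G u v → v ≡ c ⊎ Adj G c v ≡ true
    walk-stays-near-centre near here = near
    walk-stays-near-centre (inj₁ refl) (step cw walk) = walk-stays-near-centre (inj₂ cw) walk
    walk-stays-near-centre (inj₂ cu) (step uw walk) =
      walk-stays-near-centre (inj₁ (neighbour-of-neighbour cu uw)) walk

    universal : Universal G c
    universal {v} v≢c with walk-stays-near-centre (inj₁ refl) (conn c v)
    ... | inj₁ v≡c = ⊥-elim (v≢c v≡c)
    ... | inj₂ cv  = cv

    centred : Centred G c
    centred {u} {v} u≢c v≢c with Adj G u v in uv
    ... | true  = ⊥-elim (v≢c (neighbour-of-neighbour (universal u≢c) uv))
    ... | false = refl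

  pendant⇒starCentre : StarCentre G c
  pendant⇒starCentre = record { universal = universal ; centred = centred }

starCentre-adj : {G : Graph n} {c : Fin n} → StarCentre G c →
  ∀ u v → Adj G u v ≡ does (u ≟ c) xor does (v ≟ c)
starCentre-adj {G = G} {c} sc u v with u ≟ c | v ≟ c
... | yes refl | yes refl = irrefl G c
... | yes refl | no v≢c   = StarCentre.universal sc v≢c
... | no u≢c   | yes refl = adj-sym G (StarCentre.universal sc u≢c)
... | no u≢c   | no v≢c   = StarCentre.centred sc u≢c v≢c

star-centre : ∀ m → StarCentre (Star m) zero
star-centre m = record { universal = universal ; centred = centred }
  where
  universal : Universal (Star m) zero
  universal {zero}  0≢0 = ⊥-elim (0≢0 refl)
  universal {suc _} _   = refl
  centred : Centred (Star m) zero
  centred {zero}          0≢0 _   = ⊥-elim (0≢0 refl)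
  centred {suc _} {zero}  _   0≢0 = ⊥-elim (0≢0 refl)
  centred {suc _} {suc _} _   _   = refl

starCentre⇒isStar : {G : Graph n} {c : Fin n} → StarCentre G c → IsStar G
starCentre⇒isStar {n = ℕ.suc m} {G} {c} sc = m , τ , adj-preserved
  where
  open ≡-Reasoning
  τ : Fin (ℕ.suc m) ⤖ Fin (ℕ.suc m)
  τ = ↔⇒⤖ (transpose c zero)
  open Bijection τ using (to; injective)
  to-c : to c ≡ zero
  to-c rewrite dec-true (c ≟ c) refl = refl
  detects-c : ∀ u → does (u ≟ c) ≡ does (to u ≟ zero)
  detects-c u = does-⇔ (mk⇔ (λ { refl → to-c }) (λ to-u → injective (trans to-u (sym to-c)))) (u ≟ c) (to u ≟ zero)
  adj-preserved : ∀ u v → Adj G u v ≡ Adj (Star m) (to u) (to v)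
  adj-preserved u v = begin
    Adj G u v                                 ≡⟨ starCentre-adj sc u v ⟩
    does (u ≟ c) xor does (v ≟ c)             ≡⟨ cong₂ _xor_ (detects-c u) (detects-c v) ⟩
    does (to u ≟ zero) xor does (to v ≟ zero) ≡⟨ starCentre-adj (star-centre m) (to u) (to v) ⟨
    Adj (Star m) (to u) (to v)                ∎

isStar⇒centred : {G : Graph n} → IsStar G → ∃ (Centred G)
isStar⇒centred {n} {G} (m , f , adj-preserved) = c , centred
  where
  open Bijection f using (to; injective; surjective)
  c : Fin n
  c = proj₁ (surjective zero)
  to-c : to c ≡ zero
  to-c = proj₂ (surjective zero) refl
  centred : Centred G c
  centred {u} {v} u≢c v≢c = trans (adj-preserved u v)
    (StarCentre.centred (star-centre m) (λ to-u → u≢c (injective (trans to-u (sym to-c))))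
                                        (λ to-v → v≢c (injective (trans to-v (sym to-c)))))

path4-free⇒isStar : {G : Graph n} → 2 ≤ n → n ≢ 3 → Connected G → ¬ Path4 G → IsStar G
path4-free⇒isStar n≥2 n≢3 conn no-path4 =
  let _ , _ , pendant = path4-free⇒pendant n≥2 n≢3 conn no-path4
  in starCentre⇒isStar (pendant⇒starCentre conn no-path4 pendant)

corollary9 : ∀ (n : ℕ) (G : Graph n) → n ≥ 2 → Connected G →
    (OrientedLDNumber G (n ∸ 1) ⇔ (n ≡ 3 ⊎ IsStar G))
corollary9 n G n≥2 conn = mk⇔ forward backward
  where
  upper : Σ (Orientation G) λ D → Σ (Subset n) λ S → LocDom D S × ∣ S ∣ ≡ n ∸ 1
  upper = locDom-of-size-n∸1 n≥2 conn

  forward : OrientedLDNumber G (n ∸ 1) → n ≡ 3 ⊎ IsStar G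
  forward (_ , minimal) with n ℕ.≟ 3
  ... | yes n≡3 = inj₁ n≡3
  ... | no  n≢3 = inj₂ (path4-free⇒isStar n≥2 n≢3 conn λ path →
    let D , S , ld , smaller = path4⇒locDom<n∸1 path in <⇒≱ smaller (minimal D S ld))

  backward : n ≡ 3 ⊎ IsStar G → OrientedLDNumber G (n ∸ 1)
  backward (inj₁ refl) = upper , λ D S → order3⇒2≤∣S∣ D
  backward (inj₂ star) = upper , λ D S → centred⇒n∸1≤∣S∣ (proj₂ (isStar⇒centred {G = G} star)) D
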